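{- Let $\mathcal{G}$ be a concurrent game structure and $Z=(\chi,\mathrm{I},\rho)$ a state with a fully informed information perspective $\mathrm{I}$. Then for every agent $a$ and every formula $\phi$ of $\mathcal{L}^{\mathsf C}$, $\mathcal{G},Z\Vdash\phi\to\mathsf{K}_a\lnot\mathsf{K}_a\lnot\phi$.
   Context: Fix a countable set $\mathsf{Prop}$ of atomic propositions and a finite set $\mathsf{Ag}$ of agents. A concurrent game structure is a tuple $\mathcal{G}=(\mathsf{Ac},\mathsf{V},\mathsf{E},\ell,(\sim_a)_{a\in\mathsf{Ag}})$ where $\mathsf{Ac}$ is a finite set of actions, $\mathsf{V}$ is a finite set of positions, $\mathsf{E}:\mathsf{V}\times\mathsf{Ac}^{\mathsf{Ag}}\to\mathsf{V}$ is a transition function, $\ell:\mathsf{V}\to\mathcal{P}(\mathsf{Prop})$ is a valuation, and for each agent $a$, $\sim_a\subseteq(\mathsf{V}\times\mathsf{V})\cup(\mathsf{Ac}\times\mathsf{Ac})$ is an equivalence relation. A joint action is a function $\alpha:\mathsf{Ag}\to\mathsf{Ac}$; $\alpha\sim_a\beta$ iff $\alpha(b)\sim_a\beta(b)$ for all $b$. A history is a sequence $\rho=v_0\alpha_1v_1\ldots\alpha_nv_n$ of positions and joint actions with $\mathsf{E}(v_i,\alpha_{i+1})=v_{i+1}$ for all $i<n$; $\rho_{\le i}=v_0\alpha_1\ldots\alpha_iv_i$, $\mathsf{last}(\rho)=v_n$; $\mathsf{Hist}$ is the set of histories. $\rho\sim_a\rho'$ for histories iff they have the same number $n$ of joint actions,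 their $i$-th positions are $\sim_a$-related for all $i\le n$ and their $i$-th joint actions are $\sim_a$-related for all $1\le i\le n$. A strategy is a function $\mathsf{Hist}\to\mathsf{Ac}$; an assignment is a function $\chi$ from $\mathsf{Ag}$ to strategies. $\rho$ is consistent with $\chi$ for $X\subseteq\mathsf{Ag}$ if $\alpha_{i+1}(b)=\chi(b)(\rho_{\le i})$ for all $i<n$, $b\in X$. The one-step continuation is $\mathsf{X}^\chi_{\mathcal G}\rho=v_0\alpha_1\ldots\alpha_nv_n\alpha_{n+1}v_{n+1}$ with $\alpha_{n+1}(b)=\chi(b)(\rho)$ for all $b$ and $v_{n+1}=\mathsf{E}(v_n,\alpha_{n+1})$. $\mathsf{Ag}^*$ is the set of finite words over $\mathsf{Ag}$ with no two equal adjacent letters; $\mathsf{Ag}^{\ge n}$ those of length $\ge n$; $aw$ denotes $w$ prefixed by $a$. An information perspective is a set $\mathrm{I}\subseteq\mathsf{Ag}^{\ge2}$; it is fully informed if $\mathrm{I}=\mathsf{Ag}^{\ge2}$. $\mathrm{I}_a=\{b: ab\in\mathrm{I}\}\cup\{a\}$; $\mathrm{I}[a]=\{w\in\mathsf{Ag}^{\ge2}: aw\in\mathrm{I}\}\cup\{w\in\mathrm{I}: w=aw'\text{ for some }w'\in\mathsf{Ag}^*\}$. $\chi\sim^{\mathrm{I}}_a\chi'$ iff $\chi(b)=\chi'(b)$ for all $b\in\mathrm{I}_a$. A state is a triple $(\chi,\mathrm{I},\rho)$ (assignment, information perspective, history); it is $a$-consistent if $\rho$ is consistent with $\chi$ for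 $\mathrm{I}_a$. $(\chi,\mathrm{I},\rho)\trianglelefteq_a(\chi',\mathrm{I}',\rho')$ iff $\chi\sim^{\mathrm{I}}_a\chi'$, $\mathrm{I}[a]\subseteq\mathrm{I}'$, $\rho\sim_a\rho'$, and both states are $a$-consistent. For $G\subseteq\mathsf{Ag}$, $Z\trianglelefteq_GZ'$ iff $Z\trianglelefteq_aZ'$ for some $a\in G$, and $\trianglelefteq^*_G$ is the transitive closure of $\trianglelefteq_G$. Formulas of $\mathcal{L}^{\mathsf C}$: $\phi::=p\mid\bot\mid\phi\to\phi\mid\mathsf{K}_a\phi\mid\mathsf{C}_G\phi\mid\mathsf{X}\phi$ with $p\in\mathsf{Prop}$, $a\in\mathsf{Ag}$, $G\subseteq\mathsf{Ag}$ ($\lnot\phi$ is $\phi\to\bot$). Truth at $Z=(\chi,\mathrm{I},\rho)$: $\mathcal{G},Z\Vdash p$ iff $p\in\ell(\mathsf{last}(\rho))$; $\bot$ is never true; $\to$ is classical; $\mathcal{G},Z\Vdash\mathsf{K}_a\phi$ iff $\mathcal{G},Z'\Vdash\phi$ for all $Z'$ with $Z\trianglelefteq_aZ'$; $\mathcal{G},Z\Vdash\mathsf{C}_G\phi$ iff $\mathcal{G},Z'\Vdash\phi$ for all $Z'$ with $Z\trianglelefteq^*_GZ'$; $\mathcal{G},Z\Vdash\mathsf{X}\phi$ iff $\mathcal{G},(\chi,\mathrm{I},\mathsf{X}^\chi_{\mathcal G}\rho)\Vdash\phi$. -}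

module Defs where

import Level
open import Level using (0ℓ; Lift)
open import Data.Nat using (ℕ; _≤_)
open import Data.Fin using (Fin)
open import Data.Fin.Subset using (Subset; _∈_)
open import Data.List using (List; []; _∷_; length)
open import Data.Product using (Σ; _×_; ∃; _,_)
open import Data.Sum using (_⊎_)
open import Data.Unit using (⊤)
open import Data.Empty renaming (⊥ to Empty)
open import Relation.Nullary using (¬_)
open import Relation.Binary using (Rel; IsEquivalence)
open import Relation.Binary.PropositionalEquality using (_≡_)
open import Relation.Binary.Construct.Closure.Transitive using (TransClosure)

-- Concurrent game structures over n agents.
-- Ac = Fin nAc, V = Fin nV (finite sets).  The equivalence relation
-- ∼_a ⊆ (V×V) ∪ (Ac×Ac) is given by its two components.

record CGS (n : ℕ) : Set₁ where
  field
    nAc   : ℕ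
    nV    : ℕ
    E     : Fin nV → (Fin n → Fin nAc) → Fin nV
    ℓ     : Fin nV → ℕ → Set
    ∼V    : Fin n → Rel (Fin nV) 0ℓ
    ∼Ac   : Fin n → Rel (Fin nAc) 0ℓ
    ∼V-equiv  : ∀ a → IsEquivalence (∼V a)
    ∼Ac-equiv : ∀ a → IsEquivalence (∼Ac a)

NoAdj : {n : ℕ} → List (Fin n) → Set
NoAdj []           = ⊤
NoAdj (x ∷ [])     = ⊤
NoAdj (x ∷ y ∷ w)  = ¬ (x ≡ y) × NoAdj (y ∷ w)

AgGe : {n : ℕ} → ℕ → List (Fin n) → Set
AgGe k w = NoAdj w × k ≤ length w

record InfoPersp (n : ℕ) : Set₁ where
  field
    mem : List (Fin n) → Set
    wf  : ∀ w → mem w → AgGe 2 w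
open InfoPersp public

FullyInformed : {n : ℕ} → InfoPersp n → Set
FullyInformed {n} I = ∀ (w : List (Fin n)) → (mem I w → AgGe 2 w) × (AgGe 2 w → mem I w)

I-agents : {n : ℕ} → InfoPersp n → Fin n → Fin n → Set
I-agents I a b = mem I (a ∷ b ∷ []) ⊎ b ≡ a

I-shift : {n : ℕ} → InfoPersp n → Fin n → List (Fin n) → Set
I-shift I a w = (AgGe 2 w × mem I (a ∷ w)) ⊎ (mem I w × ∃ λ w' → w ≡ a ∷ w')

data Form (n : ℕ) : Set where
  atom : ℕ → Form n
  ⊥'   : Form n
  _⇒_  : Form n → Form n → Form n
  K    : Fin n → Form n → Form n
  C    : Subset n → Form n → Form n
  X    : Form n → Form n

infixr 4 _⇒_

¬' : {n : ℕ} → Form n → Form n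
¬' φ = φ ⇒ ⊥'

module Semantics {n : ℕ} (𝒢 : CGS n) where
  open CGS 𝒢

  Ag = Fin n
  Ac = Fin nAc
  V  = Fin nV

  JointAction : Set
  JointAction = Ag → Ac

  _∼JA[_]_ : JointAction → Ag → JointAction → Set
  α ∼JA[ a ] β = ∀ b → ∼Ac a (α b) (β b)

  -- A history v₀ α₁ v₁ … αₙ vₙ with v_{i+1} = E(v_i, α_{i+1});
  -- the positions after v₀ are determined by E and computed below.
  data Hist : Set where
    init : V → Hist
    _▹_  : Hist → JointAction → Hist

  last : Hist → V
  last (init v) = v
  last (ρ ▹ α)  = E (last ρ) α

  _∼H[_]_ : Hist → Ag → Hist → Set
  init v  ∼H[ a ] init v'   = ∼V a v v'
  init v  ∼H[ a ] (ρ' ▹ α') = Empty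
  (ρ ▹ α) ∼H[ a ] init v'   = Empty
  (ρ ▹ α) ∼H[ a ] (ρ' ▹ α') =
    (ρ ∼H[ a ] ρ') × (α ∼JA[ a ] α') × ∼V a (last (ρ ▹ α)) (last (ρ' ▹ α'))

  Strategy : Set
  Strategy = Hist → Ac

  Assignment : Set
  Assignment = Ag → Strategy

  Consistent : Assignment → (Ag → Set) → Hist → Set
  Consistent χ Xs (init v) = ⊤
  Consistent χ Xs (ρ ▹ α)  = Consistent χ Xs ρ × (∀ b → Xs b → α b ≡ χ b ρ)

  next : Assignment → Hist → Hist
  next χ ρ = ρ ▹ (λ b → χ b ρ)

  record State : Set₁ where
    constructor ⟨_,_,_⟩
    field
      χ : Assignment
      I : InfoPersp n
      ρ : Hist
  open State public

  AssignEq : InfoPersp n → Ag → Assignment → Assignment → Set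
  AssignEq I a χ₁ χ₂ = ∀ b → I-agents I a b → ∀ h → χ₁ b h ≡ χ₂ b h

  ConsistentState : Ag → State → Set
  ConsistentState a Z = Consistent (χ Z) (I-agents (I Z) a) (ρ Z)

  _⊴[_]_ : State → Ag → State → Set
  Z ⊴[ a ] Z' =
      AssignEq (I Z) a (χ Z) (χ Z')
    × (∀ w → I-shift (I Z) a w → mem (I Z') w)
    × (ρ Z ∼H[ a ] ρ Z')
    × ConsistentState a Z
    × ConsistentState a Z'

  ⊴G : Subset n → State → State → Set
  ⊴G G Z Z' = Σ Ag λ a → a ∈ G × Z ⊴[ a ] Z'

  ⊴G* : Subset n → State → State → Set₁
  ⊴G* G = TransClosure (⊴G G)

  _⊩_ : State → Form n → Set₁
  Z ⊩ atom p  = Lift (Level.suc 0ℓ) (ℓ (last (ρ Z)) p)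
  Z ⊩ ⊥'      = Lift (Level.suc 0ℓ) Empty
  Z ⊩ (φ ⇒ ψ) = Z ⊩ φ → Z ⊩ ψ
  Z ⊩ K a φ   = ∀ Z' → Z ⊴[ a ] Z' → Z' ⊩ φ
  Z ⊩ C G φ   = ∀ Z' → ⊴G* G Z Z' → Z' ⊩ φ
  Z ⊩ X φ     = ⟨ χ Z , I Z , next (χ Z) (ρ Z) ⟩ ⊩ φ

{-# OPTIONS --safe #-}
-- Under full information I_a is all of Ag, so χ ∼^I_a χ' forces χ = χ'
-- and is symmetric; and I[a] of any perspective lies inside Ag^{≥2} = I.
-- Hence ⊴[ a ] is symmetric out of a fully informed state, and symmetry of
-- the accessibility relation is what validates the B axiom
-- φ → K a ¬ K a ¬ φ: every ⊴[ a ]-successor sees the original state back.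
module Submission where

open import Defs
open import Data.Nat using (ℕ; s≤s; z≤n)
open import Data.Fin using (Fin; _≟_)
open import Data.List using (List; _∷_; [])
open import Data.Product using (_,_; proj₂)
open import Data.Sum using (inj₁; inj₂)
open import Data.Unit using (tt)
open import Relation.Nullary using (yes; no)
open import Relation.Binary using (IsEquivalence)
open import Relation.Binary.PropositionalEquality using (sym)

module _ {n : ℕ} where

  fullyInformed⇒I-agents : ∀ (I : InfoPersp n) → FullyInformed I →
                           ∀ a b → I-agents I a b
  fullyInformed⇒I-agents I full a b with b ≟ a
  ... | yes b≡a = inj₂ b≡a
  ... | no  b≢a = inj₁ (proj₂ (full (a ∷ b ∷ [])) (((λ a≡b → b≢a (sym a≡b)) , tt) , s≤s (s≤s z≤n)))

  I-shift⇒AgGe2 : ∀ (I : InfoPersp n) a (w : List (Fin n)) → I-shift I a w → AgGe 2 w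
  I-shift⇒AgGe2 I a w (inj₁ (w≥2 , _)) = w≥2
  I-shift⇒AgGe2 I a w (inj₂ (w∈I , _)) = wf I w w∈I

module _ {n : ℕ} (𝒢 : CGS n) where
  open CGS 𝒢
  open Semantics 𝒢

  ∼H-sym : ∀ a (ρ₁ ρ₂ : Hist) → ρ₁ ∼H[ a ] ρ₂ → ρ₂ ∼H[ a ] ρ₁
  ∼H-sym a (init _) (init _) v∼v' = IsEquivalence.sym (∼V-equiv a) v∼v'
  ∼H-sym a (ρ₁ ▹ _) (ρ₂ ▹ _) (ρ₁∼ρ₂ , α∼α' , v∼v') =
    ∼H-sym a ρ₁ ρ₂ ρ₁∼ρ₂ ,
    (λ b → IsEquivalence.sym (∼Ac-equiv a) (α∼α' b)) ,
    IsEquivalence.sym (∼V-equiv a) v∼v'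

  ⊴-sym : ∀ (Z : State) → FullyInformed (I Z) → ∀ a Z' → Z ⊴[ a ] Z' → Z' ⊴[ a ] Z
  ⊴-sym Z full a Z' (χ≈χ' , _ , ρ∼ρ' , consZ , consZ') =
    χ'≈χ , shift'⊆I , ∼H-sym a (ρ Z) (ρ Z') ρ∼ρ' , consZ' , consZ
    where
    χ'≈χ : AssignEq (I Z') a (χ Z') (χ Z)
    χ'≈χ b _ h = sym (χ≈χ' b (fullyInformed⇒I-agents (I Z) full a b) h)
    shift'⊆I : ∀ w → I-shift (I Z') a w → mem (I Z) w
    shift'⊆I w w∈shift = proj₂ (full w) (I-shift⇒AgGe2 (I Z') a w w∈shift)

  ⊩-B : ∀ {Z : State} a φ → (∀ Z' → Z ⊴[ a ] Z' → Z' ⊴[ a ] Z) →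
        Z ⊩ (φ ⇒ K a (¬' (K a (¬' φ))))
  ⊩-B {Z} a φ ⊴-back Z⊩φ Z' Z⊴Z' Z'⊩K¬φ = Z'⊩K¬φ Z (⊴-back Z' Z⊴Z') Z⊩φ

lemma6 : {n : ℕ} (𝒢 : CGS n) (Z : Semantics.State 𝒢) →
         FullyInformed (Semantics.State.I {𝒢 = 𝒢} Z) →
         (a : Fin n) (φ : Form n) →
         Semantics._⊩_ 𝒢 Z (φ ⇒ K a (¬' (K a (¬' φ))))
lemma6 𝒢 Z full a φ = ⊩-B 𝒢 a φ (⊴-sym 𝒢 Z full a)
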